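{- Let $A_1, \ldots, A_m$ be FDDS, $P(X) = \sum_{i=1}^{m} A_i X^i$, and $M(X) = \left(\sum_{i=1}^{m} A_i\right) X$. Then $P$ is injective on FDDS if and only if $M$ is injective on FDDS.
   Context: An FDDS is a pair $(S,f)$ with $S$ a finite (possibly empty) set and $f:S\to S$, up to isomorphism; sum is disjoint union and product is the direct product $(S,f)\times(T,g)=(S\times T,(s,t)\mapsto(f(s),g(t)))$. A map $Q$ from FDDS to FDDS is injective if $Q(X)=Q(Y)$ implies $X=Y$. -}

module Defs where

open import Data.Nat using (ℕ; zero; suc; _+_; _*_)
open import Data.Fin using (Fin; splitAt; join; remQuot; combine)
open import Data.Sum using (_⊎_; inj₁; inj₂)
open import Data.Product using (_,_)
import Data.Sum as Sum
open import Function using (_∘_)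
open import Relation.Binary.PropositionalEquality using (_≡_)

record FDDS : Set where
  constructor mkFDDS
  field
    size : ℕ
    map  : Fin size → Fin size
open FDDS public

record _≅_ (X Y : FDDS) : Set where
  field
    to       : Fin (size X) → Fin (size Y)
    from     : Fin (size Y) → Fin (size X)
    from∘to  : ∀ x → from (to x) ≡ x
    to∘from  : ∀ y → to (from y) ≡ y
    commutes : ∀ x → to (map X x) ≡ map Y (to x)

infix 4 _≅_

𝟘 : FDDS
𝟘 = mkFDDS 0 (λ ())

𝟙 : FDDS
𝟙 = mkFDDS 1 (λ x → x)

_⊕_ : FDDS → FDDS → FDDS
mkFDDS n f ⊕ mkFDDS m g =
  mkFDDS (n + m) (join n m ∘ Sum.map f g ∘ splitAt n)

_⊗_ : FDDS → FDDS → FDDS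
mkFDDS n f ⊗ mkFDDS m g =
  mkFDDS (n * m) (λ k → prodMap (remQuot m k))
  where
  open import Data.Product using (_×_)
  prodMap : Fin n × Fin m → Fin (n * m)
  prodMap (i , j) = combine (f i) (g j)

infixl 6 _⊕_
infixl 7 _⊗_

_^_ : FDDS → ℕ → FDDS
X ^ zero  = 𝟙
X ^ suc i = X ⊗ (X ^ i)

InjectiveFDDS : (FDDS → FDDS) → Set
InjectiveFDDS Q = ∀ X Y → Q X ≅ Q Y → X ≅ Y

-- Σ_{i=1}^{m} A_i X^i, with coefficients A : Fin m → FDDS (A zero is A_1)
polyFrom : ∀ (k m : ℕ) → (Fin m → FDDS) → FDDS → FDDS
polyFrom k zero    A X = 𝟘
polyFrom k (suc m) A X = (A Fin.zero ⊗ (X ^ suc k)) ⊕ polyFrom (suc k) m (A ∘ Fin.suc) X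
  where import Data.Fin as Fin

P : ∀ (m : ℕ) → (Fin m → FDDS) → FDDS → FDDS
P m A X = polyFrom 0 m A X

sumCoeffs : ∀ (m : ℕ) → (Fin m → FDDS) → FDDS
sumCoeffs zero    A = 𝟘
sumCoeffs (suc m) A = A Fin.zero ⊕ sumCoeffs m (A ∘ Fin.suc)
  where import Data.Fin as Fin

M : ∀ (m : ℕ) → (Fin m → FDDS) → FDDS → FDDS
M m A X = sumCoeffs m A ⊗ X

{-# OPTIONS --safe #-}
-- For a connected nonempty system Z, counting homomorphisms, X ↦ hom# Z X, turns
-- ⊕ into + and ⊗ into *.  So it sends P(X) and M(X) to Σ aᵢ xⁱ and (Σ aᵢ) x with
-- aᵢ = hom# Z Aᵢ and x = hom# Z X; as functions of x both are injective when
-- Σ aᵢ > 0 and constant when Σ aᵢ = 0, hence P(X), P(Y) have the same counts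
-- exactly when M(X), M(Y) do.  It remains to see that these counts determine a
-- system up to isomorphism.  Counts for a disconnected Z are products of counts
-- for the two halves of an invariant splitting, so the connected Z determine all
-- counts.  Then Lovász's argument applies: sorting the homomorphisms Z → X by
-- kernel matches them with the embeddings of the quotients of Z into X, so by
-- induction on the size of Z and cancellation, X and Y receive equally many
-- embeddings from every Z.  The identities of X and Y then yield embeddings
-- X → Y and Y → X, which make X ≅ Y.
module Submission where

open import Defs
open import Axiom.UniquenessOfIdentityProofs using (module Decidable⇒UIP)
open import Data.Bool using (Bool; true; false; T; not; if_then_else_)
open import Data.Bool.Properties using (T-irrelevant) renaming (_≟_ to _≟ᵇ_)
open import Data.Empty using (⊥; ⊥-elim)
open import Data.Fin using (Fin; zero; suc; punchOut; splitAt; join; _↑ˡ_; _↑ʳ_; remQuot; combine)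
import Data.Fin.Properties as Finₚ
open import Data.Fin.Permutation using (↔⇒≡)
open import Data.Nat using (ℕ; zero; suc; _+_; _*_; _≤_; _<_; z≤n; s≤s)
import Data.Nat as ℕ
open import Data.Nat.Induction using (<-wellFounded)
import Data.Nat.Properties as ℕₚ
open import Data.Product using (Σ; Σ-syntax; ∃; ∃-syntax; _×_; _,_; proj₁; proj₂)
open import Data.Product.Function.Dependent.Propositional using (Σ-↔)
open import Data.Product.Function.NonDependent.Propositional using (_×-↔_)
open import Data.Sum using (_⊎_; inj₁; inj₂; [_,_]′; fromInj₁; fromInj₂)
import Data.Sum as Sum
open import Data.Sum.Function.Propositional using (_⊎-↔_)
open import Data.Sum.Properties using ([,]-∘; [,]-cong; inj₁-injective; inj₂-injective)
open import Data.Unit using (⊤; tt)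
open import Data.Vec using (Vec; []; _∷_; lookup; tabulate; allFin)
open import Data.Vec.Properties using (lookup∘tabulate; tabulate∘lookup; tabulate-cong; lookup-allFin)
import Data.Vec.Properties as Vecₚ
open import Function using (_∘_; id)
open import Function.Bundles using (_↔_; Inverse; mk↔ₛ′; _⇔_; mk⇔; Equivalence)
open import Function.Definitions using (Injective)
import Function.Properties.Equivalence as ⇔
open import Function.Properties.Inverse using (↔-refl; ↔-sym; ↔-trans)
open import Function.Related.Propositional using (module EquationalReasoning)
import Induction.WellFounded as WF
open import Relation.Binary using (DecidableEquality; tri<; tri≈; tri>)
import Relation.Binary.Construct.On as On
open import Relation.Binary.PropositionalEquality
open import Relation.Nullary using (¬_; Dec; yes; no; contradiction; _×-dec_)
open import Relation.Nullary.Decidable using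
  (map′; True; ⌊_⌋; isNo; toWitness; fromWitness; toWitnessFalse; fromWitnessFalse;
   does-⇔; isYes≗does; dec-yes-irr; _→-dec_)
open import Relation.Unary using (Decidable)

open Inverse using (to; from; strictlyInverseˡ; strictlyInverseʳ)

private
  variable
    A B C D : Set
    n : ℕ
    W X Y Z : FDDS

-- Finite types

Finite : Set → Set
Finite A = ∃[ n ] A ↔ Fin n

↔Fin-unique : ∀ {m n} → A ↔ Fin m → A ↔ Fin n → m ≡ n
↔Fin-unique A↔m A↔n = ↔⇒≡ (↔-trans (↔-sym A↔m) A↔n)

Finite-↔ : A ↔ B → Finite B → Finite A
Finite-↔ A↔B (n , B↔n) = n , ↔-trans A↔B B↔n

Finite-× : Finite A → Finite B → Finite (A × B)
Finite-× (m , A↔m) (n , B↔n) = m * n , ↔-trans (A↔m ×-↔ B↔n) (↔-sym Finₚ.*↔×)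

Finite-Vec : Finite A → ∀ n → Finite (Vec A n)
Finite-Vec finA zero    = 1 , mk↔ₛ′ (λ _ → zero) (λ _ → []) (λ { zero → refl }) (λ { [] → refl })
Finite-Vec finA (suc n) = Finite-↔ uncons (Finite-× finA (Finite-Vec finA n))
  where
  uncons : Vec A (suc n) ↔ (A × Vec A n)
  uncons = mk↔ₛ′ (λ { (x ∷ xs) → x , xs }) (λ (x , xs) → x ∷ xs) (λ _ → refl) (λ { (_ ∷ _) → refl })

∃? : Finite A → {P : A → Set} → Decidable P → Dec (∃ P)
∃? (n , A↔n) {P} P? = map′
  (λ (i , p) → from A↔n i , p)
  (λ (a , p) → to A↔n a , subst P (sym (strictlyInverseʳ A↔n a)) p)
  (Finₚ.any? (P? ∘ from A↔n))

Subtype : (A : Set) → (A → Bool) → Set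
Subtype A p = Σ A (T ∘ p)

Subtype-≡ : ∀ {p : A → Bool} {x y : Subtype A p} → proj₁ x ≡ proj₁ y → x ≡ y
Subtype-≡ {x = a , s} {y = .a , t} refl = cong (a ,_) (T-irrelevant s t)

Subtype-split : (p : A → Bool) → A ↔ (Subtype A p ⊎ Subtype A (not ∘ p))
Subtype-split {A} p = mk↔ₛ′ (λ a → side a (p a) refl) [ proj₁ , proj₁ ]′
  (λ { (inj₁ (a , t)) → side-inj₁ a t (p a) refl ; (inj₂ (a , t)) → side-inj₂ a t (p a) refl })
  (λ a → from-side a (p a) refl)
  where
  side : ∀ a b → p a ≡ b → Subtype A p ⊎ Subtype A (not ∘ p)
  side a true  pa≡b = inj₁ (a , subst T (sym pa≡b) tt)
  side a false pa≡b = inj₂ (a , subst (T ∘ not) (sym pa≡b) tt)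
  from-side : ∀ a b pa≡b → [ proj₁ , proj₁ ]′ (side a b pa≡b) ≡ a
  from-side a true  _ = refl
  from-side a false _ = refl
  side-inj₁ : ∀ a t b pa≡b → side a b pa≡b ≡ inj₁ (a , t)
  side-inj₁ a t true  _    = cong inj₁ (Subtype-≡ refl)
  side-inj₁ a t false pa≡b = ⊥-elim (subst T pa≡b t)
  side-inj₂ : ∀ a t b pa≡b → side a b pa≡b ≡ inj₂ (a , t)
  side-inj₂ a t true  pa≡b = ⊥-elim (subst (T ∘ not) pa≡b t)
  side-inj₂ a t false _    = cong inj₂ (Subtype-≡ refl)

isInj₁ : A ⊎ B → Bool
isInj₁ = [ (λ _ → true) , (λ _ → false) ]′

isInj₁-map : ∀ {f : A → C} {g : B → D} s → isInj₁ (Sum.map f g s) ≡ isInj₁ s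
isInj₁-map (inj₁ _) = refl
isInj₁-map (inj₂ _) = refl

count : (Fin n → Bool) → ℕ
count {zero}  p = 0
count {suc n} p = (if p zero then 1 else 0) + count (p ∘ suc)

count≤ : (p : Fin n → Bool) → count p ≤ n
count≤ {zero}  p = z≤n
count≤ {suc n} p = ℕₚ.+-mono-≤ (bit≤1 (p zero)) (count≤ (p ∘ suc))
  where
  bit≤1 : ∀ b → (if b then 1 else 0) ≤ 1
  bit≤1 true  = s≤s z≤n
  bit≤1 false = z≤n

count< : (p : Fin n → Bool) {a : Fin n} → ¬ T (p a) → count p < n
count< {suc n} p {zero} ¬pa with p zero
... | true  = contradiction tt ¬pa
... | false = s≤s (count≤ (p ∘ suc))
count< {suc n} p {suc a} ¬pa with p zero
... | true  = s≤s (count< (p ∘ suc) ¬pa)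
... | false = ℕₚ.m<n⇒m<1+n (count< (p ∘ suc) ¬pa)

Subtype-Fin↔ : (p : Fin n → Bool) → Subtype (Fin n) p ↔ Fin (count p)
Subtype-Fin↔ {zero}  p = mk↔ₛ′ (λ ()) (λ ()) (λ ()) (λ ())
Subtype-Fin↔ {suc n} p = begin
  Subtype (Fin (suc n)) p                          ↔⟨ head-or-tail ⟩
  (T (p zero) ⊎ Subtype (Fin n) (p ∘ suc))         ↔⟨ T↔Fin (p zero) ⊎-↔ Subtype-Fin↔ (p ∘ suc) ⟩
  (Fin (if p zero then 1 else 0) ⊎ Fin (count (p ∘ suc))) ↔⟨ ↔-sym Finₚ.+↔⊎ ⟩
  Fin (count p)                                    ∎
  where
  open EquationalReasoning
  head-or-tail : Subtype (Fin (suc n)) p ↔ (T (p zero) ⊎ Subtype (Fin n) (p ∘ suc))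
  head-or-tail = mk↔ₛ′
    (λ { (zero , t) → inj₁ t ; (suc i , t) → inj₂ (i , t) })
    (λ { (inj₁ t) → zero , t ; (inj₂ (i , t)) → suc i , t })
    (λ { (inj₁ _) → refl ; (inj₂ _) → refl })
    (λ { (zero , _) → refl ; (suc _ , _) → refl })
  T↔Fin : ∀ b → T b ↔ Fin (if b then 1 else 0)
  T↔Fin true  = ↔-sym Finₚ.1↔⊤
  T↔Fin false = ↔-sym Finₚ.0↔⊥

Finite-Subtype : Finite A → (p : A → Bool) → Finite (Subtype A p)
Finite-Subtype (n , A↔n) p =
  count (p ∘ from A↔n) , ↔-trans (↔-sym (Σ-↔ (↔-sym A↔n) ↔-refl)) (Subtype-Fin↔ (p ∘ from A↔n))

Finite-⊎⁻ : Finite (A ⊎ B) → Finite A × Finite B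
Finite-⊎⁻ {A} {B} finA⊎B =
  Finite-↔ left (Finite-Subtype finA⊎B isInj₁) , Finite-↔ right (Finite-Subtype finA⊎B (not ∘ isInj₁))
  where
  left : A ↔ Subtype (A ⊎ B) isInj₁
  left = mk↔ₛ′ (λ a → inj₁ a , tt) (λ { (inj₁ a , _) → a ; (inj₂ _ , ()) })
    (λ { (inj₁ _ , _) → refl ; (inj₂ _ , ()) }) (λ _ → refl)
  right : B ↔ Subtype (A ⊎ B) (not ∘ isInj₁)
  right = mk↔ₛ′ (λ b → inj₂ b , tt) (λ { (inj₁ _ , ()) ; (inj₂ b , _) → b })
    (λ { (inj₁ _ , ()) ; (inj₂ _ , _) → refl }) (λ _ → refl)

⊎-cancelʳ-↔ : ∀ {A B C D : Set} → Finite (A ⊎ C) → (A ⊎ C) ↔ (B ⊎ D) → C ↔ D → A ↔ B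
⊎-cancelʳ-↔ {B = B} finA⊎C A⊎C↔B⊎D C↔D =
  let (a , A↔a) , (c , C↔c) = Finite-⊎⁻ finA⊎C
      (b , B↔b) , _         = Finite-⊎⁻ (Finite-↔ (↔-sym A⊎C↔B⊎D) finA⊎C)
      a+c≡b+c = ↔Fin-unique
        (↔-trans (A↔a ⊎-↔ C↔c) (↔-sym Finₚ.+↔⊎))
        (↔-trans A⊎C↔B⊎D (↔-trans (B↔b ⊎-↔ ↔-trans (↔-sym C↔D) C↔c) (↔-sym Finₚ.+↔⊎)))
  in ↔-trans A↔a (subst (λ k → Fin k ↔ B) (sym (ℕₚ.+-cancelʳ-≡ c a b a+c≡b+c)) (↔-sym B↔b))

Σ-fibres : (f : A → B) → A ↔ Σ B (λ b → Σ A (λ a → f a ≡ b))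
Σ-fibres f = mk↔ₛ′ (λ a → f a , a , refl) (proj₁ ∘ proj₂) (λ { (_ , _ , refl) → refl }) (λ _ → refl)

Σ-split : (_≟_ : DecidableEquality A) (a₀ : A) {P : A → Set} →
          Σ A P ↔ (P a₀ ⊎ Σ (Subtype A (λ a → isNo (a ≟ a₀))) (P ∘ proj₁))
Σ-split {A} _≟_ a₀ {P} = mk↔ₛ′ (λ (a , p) → side a p (a ≟ a₀)) unside side-unside
  (λ (a , p) → unside-side a p (a ≟ a₀))
  where
  side : ∀ a → P a → Dec (a ≡ a₀) → P a₀ ⊎ Σ (Subtype A (λ a → isNo (a ≟ a₀))) (P ∘ proj₁)
  side a p (yes refl)  = inj₁ p
  side a p (no  a≢a₀) = inj₂ ((a , fromWitnessFalse a≢a₀) , p)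
  unside : P a₀ ⊎ Σ (Subtype A (λ a → isNo (a ≟ a₀))) (P ∘ proj₁) → Σ A P
  unside (inj₁ p)             = a₀ , p
  unside (inj₂ ((a , _) , p)) = a , p
  unside-side : ∀ a p a≟a₀ → unside (side a p a≟a₀) ≡ (a , p)
  unside-side a p (yes refl) = refl
  unside-side a p (no  _)    = refl
  side-unside : ∀ s → side (proj₁ (unside s)) (proj₂ (unside s)) (proj₁ (unside s) ≟ a₀) ≡ s
  side-unside (inj₁ p) rewrite dec-yes-irr (a₀ ≟ a₀) (Decidable⇒UIP.≡-irrelevant _≟_) refl = refl
  side-unside (inj₂ ((a , a≢a₀) , p)) = side-no a p (a ≟ a₀) a≢a₀
    where
    side-no : ∀ a p (a≟a₀ : Dec (a ≡ a₀)) (a≢a₀ : T (isNo (a ≟ a₀))) →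
              side a p a≟a₀ ≡ inj₂ ((a , a≢a₀) , p)
    side-no a p (yes a≡a₀) a≢a₀ = contradiction a≡a₀ (toWitnessFalse a≢a₀)
    side-no a p (no  _)    _    = cong (λ t → inj₂ ((a , t) , p)) (T-irrelevant _ _)

injective⇒surjective : ∀ {m n} {f : Fin m → Fin n} → Injective _≡_ _≡_ f → n ≤ m →
                       ∀ y → ∃ λ x → f x ≡ y
injective⇒surjective {m} {suc n} {f} f-inj n≤m y with Finₚ.any? (λ x → f x Finₚ.≟ y)
... | yes hit = hit
... | no  miss = contradiction (Finₚ.injective⇒≤ punched-injective) (ℕₚ.<⇒≱ n≤m)
  where
  y≢f : ∀ x → y ≢ f x
  y≢f x y≡fx = miss (x , sym y≡fx)
  punched-injective : Injective _≡_ _≡_ (λ x → punchOut (y≢f x))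
  punched-injective e = f-inj (Finₚ.punchOut-injective (y≢f _) (y≢f _) e)

-- Homomorphisms

IsHom : (Z X : FDDS) → (Fin (size Z) → Fin (size X)) → Set
IsHom Z X h = ∀ a → h (map Z a) ≡ map X (h a)

isHom? : (Z X : FDDS) → Decidable (IsHom Z X)
isHom? Z X h = Finₚ.all? (λ a → h (map Z a) Finₚ.≟ map X (h a))

-- Homomorphisms are stored as tables, so that Hom Z X is finite and equality of
-- homomorphisms is pointwise (Hom-≡).
record Hom (Z X : FDDS) : Set where
  constructor hom
  field
    table   : Vec (Fin (size X)) (size Z)
    isHom-T : True (isHom? Z X (lookup table))

apply : Hom Z X → Fin (size Z) → Fin (size X)
apply = lookup ∘ Hom.table

apply-isHom : (H : Hom Z X) → IsHom Z X (apply H)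
apply-isHom H = toWitness (Hom.isHom-T H)

mkHom : (h : Fin (size Z) → Fin (size X)) → IsHom Z X h → Hom Z X
mkHom {Z} {X} h h-hom = hom (tabulate h) (fromWitness λ a → begin
  lookup (tabulate h) (map Z a)  ≡⟨ lookup∘tabulate h (map Z a) ⟩
  h (map Z a)                    ≡⟨ h-hom a ⟩
  map X (h a)                    ≡⟨ cong (map X) (lookup∘tabulate h a) ⟨
  map X (lookup (tabulate h) a)  ∎)
  where open ≡-Reasoning

apply-mkHom : ∀ {Z X} h (h-hom : IsHom Z X h) a → apply (mkHom {Z} {X} h h-hom) a ≡ h a
apply-mkHom h _ = lookup∘tabulate h

Hom-≡ : {H G : Hom Z X} → (∀ a → apply H a ≡ apply G a) → H ≡ G
Hom-≡ {H = hom v s} {G = hom w t} H≗G = hom-cong (begin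
  v                   ≡⟨ tabulate∘lookup v ⟨
  tabulate (lookup v) ≡⟨ tabulate-cong H≗G ⟩
  tabulate (lookup w) ≡⟨ tabulate∘lookup w ⟩
  w                   ∎)
  where
  open ≡-Reasoning
  hom-cong : v ≡ w → hom v s ≡ hom w t
  hom-cong refl = cong (hom v) (T-irrelevant s t)

Finite-Hom : ∀ Z X → Finite (Hom Z X)
Finite-Hom Z X = Finite-↔ (mk↔ₛ′ (λ (hom v t) → v , t) (λ (v , t) → hom v t) (λ _ → refl) (λ _ → refl))
  (Finite-Subtype (Finite-Vec (size X , ↔-refl) (size Z)) _)

Hom-↔ : ∀ {Z X Z′ X′} (φ : Hom Z X → Hom Z′ X′) (ψ : Hom Z′ X′ → Hom Z X) →
        (∀ H a → apply (φ (ψ H)) a ≡ apply H a) → (∀ H a → apply (ψ (φ H)) a ≡ apply H a) →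
        Hom Z X ↔ Hom Z′ X′
Hom-↔ φ ψ φψ ψφ = mk↔ₛ′ φ ψ (Hom-≡ ∘ φψ) (Hom-≡ ∘ ψφ)

idʰ : Hom X X
idʰ = mkHom id (λ _ → refl)

infixr 9 _∘ʰ_
_∘ʰ_ : Hom Y W → Hom Z Y → Hom Z W
G ∘ʰ H = mkHom (apply G ∘ apply H) (λ a → trans (cong (apply G) (apply-isHom H a)) (apply-isHom G _))

apply-∘ʰ : ∀ (G : Hom Y W) (H : Hom Z Y) a → apply (G ∘ʰ H) a ≡ apply G (apply H a)
apply-∘ʰ G H = lookup∘tabulate (apply G ∘ apply H)

ι₁ : ∀ {X Y} → Hom X (X ⊕ Y)
ι₁ {X} {Y} = mkHom (_↑ˡ size Y) λ a →
  cong (join (size X) (size Y) ∘ Sum.map (map X) (map Y)) (sym (Finₚ.splitAt-↑ˡ (size X) a (size Y)))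

ι₂ : ∀ {X Y} → Hom Y (X ⊕ Y)
ι₂ {X} {Y} = mkHom (size X ↑ʳ_) λ a →
  cong (join (size X) (size Y) ∘ Sum.map (map X) (map Y)) (sym (Finₚ.splitAt-↑ʳ (size X) (size Y) a))

[_,_]ʰ : ∀ {X Y W} → Hom X W → Hom Y W → Hom (X ⊕ Y) W
[_,_]ʰ {X} {Y} {W} H₁ H₂ = mkHom copair λ a → begin
  copair (join (size X) (size Y) (Sum.map (map X) (map Y) (splitAt (size X) a)))
    ≡⟨ cong [ apply H₁ , apply H₂ ]′
            (Finₚ.splitAt-join (size X) (size Y) (Sum.map (map X) (map Y) (splitAt (size X) a))) ⟩
  [ apply H₁ , apply H₂ ]′ (Sum.map (map X) (map Y) (splitAt (size X) a))
    ≡⟨ step (splitAt (size X) a) ⟩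
  map W (copair a) ∎
  where
  open ≡-Reasoning
  copair : Fin (size X + size Y) → Fin (size W)
  copair = [ apply H₁ , apply H₂ ]′ ∘ splitAt (size X)
  step : ∀ s → [ apply H₁ , apply H₂ ]′ (Sum.map (map X) (map Y) s) ≡ map W ([ apply H₁ , apply H₂ ]′ s)
  step (inj₁ a) = apply-isHom H₁ a
  step (inj₂ b) = apply-isHom H₂ b

apply-ι₁ : ∀ {X Y} a → apply (ι₁ {X} {Y}) a ≡ a ↑ˡ size Y
apply-ι₁ {Y = Y} = lookup∘tabulate (_↑ˡ size Y)

apply-ι₂ : ∀ {X Y} b → apply (ι₂ {X} {Y}) b ≡ size X ↑ʳ b
apply-ι₂ {X} = lookup∘tabulate (size X ↑ʳ_)

apply-[,]ʰ : ∀ {X Y W} (H₁ : Hom X W) (H₂ : Hom Y W) a →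
             apply [ H₁ , H₂ ]ʰ a ≡ [ apply H₁ , apply H₂ ]′ (splitAt (size X) a)
apply-[,]ʰ {X} H₁ H₂ = lookup∘tabulate ([ apply H₁ , apply H₂ ]′ ∘ splitAt (size X))

Hom-⊕ˡ : ∀ {X Y W} → Hom (X ⊕ Y) W ↔ (Hom X W × Hom Y W)
Hom-⊕ˡ {X} {Y} {W} = mk↔ₛ′ (λ H → H ∘ʰ i₁ , H ∘ʰ i₂) (λ (H₁ , H₂) → [ H₁ , H₂ ]ʰ)
  (λ (H₁ , H₂) → cong₂ _,_ (Hom-≡ ([,]-ι₁ H₁ H₂)) (Hom-≡ ([,]-ι₂ H₁ H₂)))
  (λ H → Hom-≡ ([ι₁,ι₂] H))
  where
  open ≡-Reasoning
  i₁ = ι₁ {X} {Y}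
  i₂ = ι₂ {X} {Y}
  sa = splitAt (size X) {size Y}

  [,]-ι₁ : ∀ H₁ H₂ a → apply ([ H₁ , H₂ ]ʰ ∘ʰ i₁) a ≡ apply H₁ a
  [,]-ι₁ H₁ H₂ a = begin
    apply ([ H₁ , H₂ ]ʰ ∘ʰ i₁) a                   ≡⟨ apply-∘ʰ [ H₁ , H₂ ]ʰ i₁ a ⟩
    apply [ H₁ , H₂ ]ʰ (apply i₁ a)                ≡⟨ cong (apply [ H₁ , H₂ ]ʰ) (apply-ι₁ {X} {Y} a) ⟩
    apply [ H₁ , H₂ ]ʰ (a ↑ˡ size Y)               ≡⟨ apply-[,]ʰ H₁ H₂ _ ⟩
    [ apply H₁ , apply H₂ ]′ (sa (a ↑ˡ size Y))    ≡⟨ cong [ apply H₁ , apply H₂ ]′ (Finₚ.splitAt-↑ˡ (size X) a (size Y)) ⟩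
    apply H₁ a                                     ∎

  [,]-ι₂ : ∀ H₁ H₂ b → apply ([ H₁ , H₂ ]ʰ ∘ʰ i₂) b ≡ apply H₂ b
  [,]-ι₂ H₁ H₂ b = begin
    apply ([ H₁ , H₂ ]ʰ ∘ʰ i₂) b                   ≡⟨ apply-∘ʰ [ H₁ , H₂ ]ʰ i₂ b ⟩
    apply [ H₁ , H₂ ]ʰ (apply i₂ b)                ≡⟨ cong (apply [ H₁ , H₂ ]ʰ) (apply-ι₂ {X} {Y} b) ⟩
    apply [ H₁ , H₂ ]ʰ (size X ↑ʳ b)               ≡⟨ apply-[,]ʰ H₁ H₂ _ ⟩
    [ apply H₁ , apply H₂ ]′ (sa (size X ↑ʳ b))    ≡⟨ cong [ apply H₁ , apply H₂ ]′ (Finₚ.splitAt-↑ʳ (size X) (size Y) b) ⟩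
    apply H₂ b                                     ∎

  [ι₁,ι₂] : ∀ H a → apply [ H ∘ʰ i₁ , H ∘ʰ i₂ ]ʰ a ≡ apply H a
  [ι₁,ι₂] H a = begin
    apply [ H ∘ʰ i₁ , H ∘ʰ i₂ ]ʰ a                          ≡⟨ apply-[,]ʰ (H ∘ʰ i₁) (H ∘ʰ i₂) a ⟩
    [ apply (H ∘ʰ i₁) , apply (H ∘ʰ i₂) ]′ (sa a)          ≡⟨ [,]-cong apply-Hι₁ apply-Hι₂ (sa a) ⟩
    [ apply H ∘ (_↑ˡ size Y) , apply H ∘ (size X ↑ʳ_) ]′ (sa a) ≡⟨ [,]-∘ (apply H) (sa a) ⟨
    apply H (join (size X) (size Y) (sa a))                 ≡⟨ cong (apply H) (Finₚ.join-splitAt (size X) (size Y) a) ⟩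
    apply H a                                               ∎
    where
    apply-Hι₁ : ∀ a → apply (H ∘ʰ i₁) a ≡ apply H (a ↑ˡ size Y)
    apply-Hι₁ a = trans (apply-∘ʰ H i₁ a) (cong (apply H) (apply-ι₁ {X} {Y} a))
    apply-Hι₂ : ∀ b → apply (H ∘ʰ i₂) b ≡ apply H (size X ↑ʳ b)
    apply-Hι₂ b = trans (apply-∘ʰ H i₂ b) (cong (apply H) (apply-ι₂ {X} {Y} b))

π₁ : ∀ {X Y} → Hom (X ⊗ Y) X
π₁ {X} {Y} = mkHom (proj₁ ∘ remQuot {size X} (size Y)) λ k →
  let (i , j) = remQuot {size X} (size Y) k in cong proj₁ (Finₚ.remQuot-combine (map X i) (map Y j))

π₂ : ∀ {X Y} → Hom (X ⊗ Y) Y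
π₂ {X} {Y} = mkHom (proj₂ ∘ remQuot {size X} (size Y)) λ k →
  let (i , j) = remQuot {size X} (size Y) k in cong proj₂ (Finₚ.remQuot-combine (map X i) (map Y j))

⟨_,_⟩ʰ : ∀ {Z X Y} → Hom Z X → Hom Z Y → Hom Z (X ⊗ Y)
⟨_,_⟩ʰ {X = X} {Y} H₁ H₂ = mkHom (λ a → combine (apply H₁ a) (apply H₂ a)) λ a →
  trans (cong₂ combine (apply-isHom H₁ a) (apply-isHom H₂ a))
        (cong (λ (i , j) → combine (map X i) (map Y j))
              (sym (Finₚ.remQuot-combine (apply H₁ a) (apply H₂ a))))

apply-π₁ : ∀ {X Y} k → apply (π₁ {X} {Y}) k ≡ proj₁ (remQuot {size X} (size Y) k)
apply-π₁ {X} {Y} = lookup∘tabulate (proj₁ ∘ remQuot {size X} (size Y))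

apply-π₂ : ∀ {X Y} k → apply (π₂ {X} {Y}) k ≡ proj₂ (remQuot {size X} (size Y) k)
apply-π₂ {X} {Y} = lookup∘tabulate (proj₂ ∘ remQuot {size X} (size Y))

apply-⟨,⟩ʰ : ∀ {Z X Y} (H₁ : Hom Z X) (H₂ : Hom Z Y) a →
             apply ⟨ H₁ , H₂ ⟩ʰ a ≡ combine (apply H₁ a) (apply H₂ a)
apply-⟨,⟩ʰ H₁ H₂ = lookup∘tabulate (λ a → combine (apply H₁ a) (apply H₂ a))

Hom-⊗ : ∀ {Z X Y} → Hom Z (X ⊗ Y) ↔ (Hom Z X × Hom Z Y)
Hom-⊗ {Z} {X} {Y} = mk↔ₛ′ (λ H → p₁ ∘ʰ H , p₂ ∘ʰ H) (λ (H₁ , H₂) → ⟨ H₁ , H₂ ⟩ʰ)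
  (λ (H₁ , H₂) → cong₂ _,_ (Hom-≡ (π₁-⟨,⟩ H₁ H₂)) (Hom-≡ (π₂-⟨,⟩ H₁ H₂)))
  (λ H → Hom-≡ (⟨π₁,π₂⟩ H))
  where
  open ≡-Reasoning
  p₁ = π₁ {X} {Y}
  p₂ = π₂ {X} {Y}
  rq = remQuot {size X} (size Y)

  π₁-⟨,⟩ : ∀ H₁ H₂ a → apply (p₁ ∘ʰ ⟨ H₁ , H₂ ⟩ʰ) a ≡ apply H₁ a
  π₁-⟨,⟩ H₁ H₂ a = begin
    apply (p₁ ∘ʰ ⟨ H₁ , H₂ ⟩ʰ) a                   ≡⟨ apply-∘ʰ p₁ ⟨ H₁ , H₂ ⟩ʰ a ⟩
    apply p₁ (apply ⟨ H₁ , H₂ ⟩ʰ a)                ≡⟨ apply-π₁ {X} {Y} _ ⟩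
    proj₁ (rq (apply ⟨ H₁ , H₂ ⟩ʰ a))              ≡⟨ cong (proj₁ ∘ rq) (apply-⟨,⟩ʰ H₁ H₂ a) ⟩
    proj₁ (rq (combine (apply H₁ a) (apply H₂ a))) ≡⟨ cong proj₁ (Finₚ.remQuot-combine (apply H₁ a) (apply H₂ a)) ⟩
    apply H₁ a                                     ∎

  π₂-⟨,⟩ : ∀ H₁ H₂ a → apply (p₂ ∘ʰ ⟨ H₁ , H₂ ⟩ʰ) a ≡ apply H₂ a
  π₂-⟨,⟩ H₁ H₂ a = begin
    apply (p₂ ∘ʰ ⟨ H₁ , H₂ ⟩ʰ) a                   ≡⟨ apply-∘ʰ p₂ ⟨ H₁ , H₂ ⟩ʰ a ⟩
    apply p₂ (apply ⟨ H₁ , H₂ ⟩ʰ a)                ≡⟨ apply-π₂ {X} {Y} _ ⟩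
    proj₂ (rq (apply ⟨ H₁ , H₂ ⟩ʰ a))              ≡⟨ cong (proj₂ ∘ rq) (apply-⟨,⟩ʰ H₁ H₂ a) ⟩
    proj₂ (rq (combine (apply H₁ a) (apply H₂ a))) ≡⟨ cong proj₂ (Finₚ.remQuot-combine (apply H₁ a) (apply H₂ a)) ⟩
    apply H₂ a                                     ∎

  ⟨π₁,π₂⟩ : ∀ H a → apply ⟨ p₁ ∘ʰ H , p₂ ∘ʰ H ⟩ʰ a ≡ apply H a
  ⟨π₁,π₂⟩ H a = begin
    apply ⟨ p₁ ∘ʰ H , p₂ ∘ʰ H ⟩ʰ a                   ≡⟨ apply-⟨,⟩ʰ (p₁ ∘ʰ H) (p₂ ∘ʰ H) a ⟩
    combine (apply (p₁ ∘ʰ H) a) (apply (p₂ ∘ʰ H) a) ≡⟨ cong₂ combine (trans (apply-∘ʰ p₁ H a) (apply-π₁ {X} {Y} _))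
                                                                    (trans (apply-∘ʰ p₂ H a) (apply-π₂ {X} {Y} _)) ⟩
    combine (proj₁ (rq (apply H a))) (proj₂ (rq (apply H a)))
                                                    ≡⟨ Finₚ.combine-remQuot {size X} (size Y) (apply H a) ⟩
    apply H a                                       ∎

Hom-𝟙 : ∀ {Z} → Hom Z 𝟙 ↔ ⊤
Hom-𝟙 = mk↔ₛ′ _ (λ _ → mkHom (λ _ → zero) (λ _ → refl)) (λ _ → refl)
  (λ H → Hom-≡ λ a → trans (lookup∘tabulate _ a) (sym (Fin1-unique (apply H a))))
  where
  Fin1-unique : (i : Fin 1) → i ≡ zero
  Fin1-unique zero = refl

Hom-𝟘 : ∀ {Z} → Fin (size Z) → Hom Z 𝟘 ↔ ⊥
Hom-𝟘 a = mk↔ₛ′ (λ H → Finₚ.¬Fin0 (apply H a)) (λ ()) (λ ())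
  (λ H → ⊥-elim (Finₚ.¬Fin0 (apply H a)))

Hom-from-empty : ∀ {f X} → Hom (mkFDDS 0 f) X ↔ ⊤
Hom-from-empty = mk↔ₛ′ _ (λ _ → mkHom (λ ()) (λ ())) (λ _ → refl) (λ _ → Hom-≡ (λ ()))

↔⇒≅ : (e : Fin (size X) ↔ Fin (size Y)) → IsHom X Y (to e) → X ≅ Y
↔⇒≅ e e-hom = record
  { to = to e ; from = from e ; from∘to = strictlyInverseʳ e ; to∘from = strictlyInverseˡ e ; commutes = e-hom }

≅-sym : X ≅ Y → Y ≅ X
≅-sym {X} {Y} X≅Y = record
  { to = i.from ; from = i.to ; from∘to = i.to∘from ; to∘from = i.from∘to ; commutes = from-commutes }
  where
  module i = _≅_ X≅Y
  from-commutes : ∀ y → i.from (map Y y) ≡ map X (i.from y)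
  from-commutes y = begin
    i.from (map Y y)                 ≡⟨ cong (i.from ∘ map Y) (i.to∘from y) ⟨
    i.from (map Y (i.to (i.from y))) ≡⟨ cong i.from (i.commutes (i.from y)) ⟨
    i.from (i.to (map X (i.from y))) ≡⟨ i.from∘to (map X (i.from y)) ⟩
    map X (i.from y)                 ∎
    where open ≡-Reasoning

≅⇒Hom : X ≅ Y → Hom X Y
≅⇒Hom X≅Y = mkHom (_≅_.to X≅Y) (_≅_.commutes X≅Y)

≅⇒Hom-inverse : (X≅Y : X ≅ Y) → ∀ x → apply (≅⇒Hom (≅-sym X≅Y)) (apply (≅⇒Hom X≅Y) x) ≡ x
≅⇒Hom-inverse X≅Y x = begin
  apply (≅⇒Hom (≅-sym X≅Y)) (apply (≅⇒Hom X≅Y) x) ≡⟨ lookup∘tabulate i.from _ ⟩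
  i.from (apply (≅⇒Hom X≅Y) x)                    ≡⟨ cong i.from (lookup∘tabulate i.to x) ⟩
  i.from (i.to x)                                 ≡⟨ i.from∘to x ⟩
  x                                               ∎
  where
  open ≡-Reasoning
  module i = _≅_ X≅Y

Hom-resp-≅ʳ : ∀ {Z X Y} → X ≅ Y → Hom Z X ↔ Hom Z Y
Hom-resp-≅ʳ X≅Y = Hom-↔ (F ∘ʰ_) (G ∘ʰ_)
  (λ H a → trans (apply-∘ʰ F (G ∘ʰ H) a)
                 (trans (cong (apply F) (apply-∘ʰ G H a)) (≅⇒Hom-inverse (≅-sym X≅Y) _)))
  (λ H a → trans (apply-∘ʰ G (F ∘ʰ H) a)
                 (trans (cong (apply G) (apply-∘ʰ F H a)) (≅⇒Hom-inverse X≅Y _)))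
  where
  F = ≅⇒Hom X≅Y
  G = ≅⇒Hom (≅-sym X≅Y)

Hom-resp-≅ˡ : ∀ {Z W X} → Z ≅ W → Hom Z X ↔ Hom W X
Hom-resp-≅ˡ Z≅W = Hom-↔ (_∘ʰ G) (_∘ʰ F)
  (λ H a → trans (apply-∘ʰ (H ∘ʰ F) G a)
                 (trans (apply-∘ʰ H F _) (cong (apply H) (≅⇒Hom-inverse (≅-sym Z≅W) a))))
  (λ H a → trans (apply-∘ʰ (H ∘ʰ G) F a)
                 (trans (apply-∘ʰ H G _) (cong (apply H) (≅⇒Hom-inverse Z≅W a))))
  where
  F = ≅⇒Hom Z≅W
  G = ≅⇒Hom (≅-sym Z≅W)

-- Connected systems

Invariant : (Z : FDDS) → (Fin (size Z) → Bool) → Set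
Invariant Z U = ∀ a → U (map Z a) ≡ U a

Connected : FDDS → Set
Connected Z = ∀ U → Invariant Z U → ∀ a b → U a ≡ U b

restrict : (Z : FDDS) (U : Fin (size Z) → Bool) → Invariant Z U → FDDS
restrict Z U U-inv = mkFDDS (count U) (to points ∘ step ∘ from points)
  where
  points = Subtype-Fin↔ U
  step : Subtype (Fin (size Z)) U → Subtype (Fin (size Z)) U
  step (a , t) = map Z a , subst T (sym (U-inv a)) t

record Splitting (Z : FDDS) : Set where
  field
    U         : Fin (size Z) → Bool
    invariant : Invariant Z U
    inside    : ∃ λ a → U a ≡ true
    outside   : ∃ λ b → U b ≡ false

  inner : FDDS
  inner = restrict Z U invariant

  outer : FDDS
  outer = restrict Z (not ∘ U) (cong not ∘ invariant)

  inner-smaller : size inner < size Z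
  inner-smaller = count< U (subst T (proj₂ outside))

  outer-smaller : size outer < size Z
  outer-smaller = count< (not ∘ U) (subst (T ∘ not) (proj₂ inside))

  inner⊕outer≅Z : inner ⊕ outer ≅ Z
  inner⊕outer≅Z = ↔⇒≅ e λ k → begin
    to e (map (inner ⊕ outer) k)
      ≡⟨ cong glue (Finₚ.splitAt-join (count U) (count (not ∘ U))
                                      (Sum.map (map inner) (map outer) (splitAt (count U) k))) ⟩
    glue (Sum.map (map inner) (map outer) (splitAt (count U) k))
      ≡⟨ glue-step (splitAt (count U) k) ⟩
    map Z (to e k) ∎
    where
    open ≡-Reasoning
    e : Fin (count U + count (not ∘ U)) ↔ Fin (size Z)
    e = ↔-trans Finₚ.+↔⊎ (↔-trans (↔-sym (Subtype-Fin↔ U) ⊎-↔ ↔-sym (Subtype-Fin↔ (not ∘ U)))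
                                  (↔-sym (Subtype-split U)))
    glue : Fin (count U) ⊎ Fin (count (not ∘ U)) → Fin (size Z)
    glue = [ proj₁ , proj₁ ]′ ∘ Sum.map (from (Subtype-Fin↔ U)) (from (Subtype-Fin↔ (not ∘ U)))
    glue-step : ∀ s → glue (Sum.map (map inner) (map outer) s) ≡ map Z (glue s)
    glue-step (inj₁ j) = cong proj₁ (strictlyInverseʳ (Subtype-Fin↔ U) _)
    glue-step (inj₂ j) = cong proj₁ (strictlyInverseʳ (Subtype-Fin↔ (not ∘ U)) _)

  Hom-split : ∀ {X} → Hom Z X ↔ (Hom inner X × Hom outer X)
  Hom-split = ↔-trans (Hom-resp-≅ˡ (≅-sym inner⊕outer≅Z)) Hom-⊕ˡ

connected-or-splitting : ∀ Z → Connected Z ⊎ Splitting Z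
connected-or-splitting Z with ∃? (Finite-Vec (2 , ↔-sym Finₚ.2↔Bool) (size Z)) splits?
  where
  splits? : Decidable λ v →
    Invariant Z (lookup v) × (∃ λ a → lookup v a ≡ true) × (∃ λ b → lookup v b ≡ false)
  splits? v = Finₚ.all? (λ a → lookup v (map Z a) ≟ᵇ lookup v a)
         ×-dec Finₚ.any? (λ a → lookup v a ≟ᵇ true)
         ×-dec Finₚ.any? (λ b → lookup v b ≟ᵇ false)
... | yes (v , inv , inside , outside) =
  inj₂ (record { U = lookup v ; invariant = inv ; inside = inside ; outside = outside })
... | no ¬split = inj₁ constant
  where
  no-split : ∀ U → Invariant Z U → ∀ {a b} → U a ≡ true → U b ≡ false → ⊥
  no-split U inv {a} {b} Ua Ub = ¬split
    ( tabulate U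
    , (λ c → trans (lookup∘tabulate U (map Z c)) (trans (inv c) (sym (lookup∘tabulate U c))))
    , (a , trans (lookup∘tabulate U a) Ua)
    , (b , trans (lookup∘tabulate U b) Ub))
  constant : Connected Z
  constant U inv a b with U a in Ua | U b in Ub
  ... | true  | true  = refl
  ... | false | false = refl
  ... | true  | false = ⊥-elim (no-split U inv Ua Ub)
  ... | false | true  = ⊥-elim (no-split U inv Ub Ua)

size-rec : (P : FDDS → Set) → (∀ Z → (∀ {W} → size W < size Z → P W) → P Z) → ∀ Z → P Z
size-rec = WF.All.wfRec (On.wellFounded size <-wellFounded) _

Hom↔-of-connected : ∀ {X Y} → (∀ Z → Connected Z → Fin (size Z) → Hom Z X ↔ Hom Z Y) →
                    ∀ Z → Hom Z X ↔ Hom Z Y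
Hom↔-of-connected {X} {Y} connected↔ = size-rec _ step
  where
  step : ∀ Z → (∀ {W} → size W < size Z → Hom W X ↔ Hom W Y) → Hom Z X ↔ Hom Z Y
  step (mkFDDS zero f) _ = ↔-trans Hom-from-empty (↔-sym Hom-from-empty)
  step Z@(mkFDDS (suc n) f) smaller↔ with connected-or-splitting Z
  ... | inj₁ Z-connected = connected↔ Z Z-connected zero
  ... | inj₂ σ =
    ↔-trans Hom-split (↔-trans (smaller↔ inner-smaller ×-↔ smaller↔ outer-smaller) (↔-sym Hom-split))
    where open Splitting σ

data Lands {Z X Y : FDDS} (H : Hom Z (X ⊕ Y)) : Set where
  in₁ : (H₁ : Hom Z X) → (∀ a → splitAt (size X) (apply H a) ≡ inj₁ (apply H₁ a)) → Lands H
  in₂ : (H₂ : Hom Z Y) → (∀ a → splitAt (size X) (apply H a) ≡ inj₂ (apply H₂ a)) → Lands H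

module _ {Z X Y : FDDS} (Z-connected : Connected Z) (z₀ : Fin (size Z)) (H : Hom Z (X ⊕ Y)) where
  private
    tag : Fin (size Z) → Fin (size X) ⊎ Fin (size Y)
    tag = splitAt (size X) ∘ apply H

    tag-step : ∀ a → tag (map Z a) ≡ Sum.map (map X) (map Y) (tag a)
    tag-step a = trans (cong (splitAt (size X)) (apply-isHom H a)) (Finₚ.splitAt-join (size X) (size Y) _)

    same-side : ∀ a → isInj₁ (tag a) ≡ isInj₁ (tag z₀)
    same-side a = Z-connected (isInj₁ ∘ tag) (λ a → trans (cong isInj₁ (tag-step a)) (isInj₁-map (tag a))) a z₀

  lands : Lands H
  lands with tag z₀ in tag₀
  ... | inj₁ x₀ = in₁ (mkHom h₁ h₁-hom) λ a →
    trans (tagged a) (cong inj₁ (sym (apply-mkHom {Z} {X} h₁ h₁-hom a)))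
    where
    h₁ = fromInj₁ (λ _ → x₀) ∘ tag
    tagged : ∀ a → tag a ≡ inj₁ (h₁ a)
    tagged a with tag a in tagₐ
    ... | inj₁ _ = refl
    ... | inj₂ _ = contradiction (trans (sym (cong isInj₁ tagₐ)) (trans (same-side a) (cong isInj₁ tag₀))) λ ()
    h₁-hom : IsHom Z X h₁
    h₁-hom a = inj₁-injective
      (trans (sym (tagged (map Z a))) (trans (tag-step a) (cong (Sum.map (map X) (map Y)) (tagged a))))
  ... | inj₂ y₀ = in₂ (mkHom h₂ h₂-hom) λ a →
    trans (tagged a) (cong inj₂ (sym (apply-mkHom {Z} {Y} h₂ h₂-hom a)))
    where
    h₂ = fromInj₂ (λ _ → y₀) ∘ tag
    tagged : ∀ a → tag a ≡ inj₂ (h₂ a)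
    tagged a with tag a in tagₐ
    ... | inj₁ _ = contradiction (trans (sym (cong isInj₁ tagₐ)) (trans (same-side a) (cong isInj₁ tag₀))) λ ()
    ... | inj₂ _ = refl
    h₂-hom : IsHom Z Y h₂
    h₂-hom a = inj₂-injective
      (trans (sym (tagged (map Z a))) (trans (tag-step a) (cong (Sum.map (map X) (map Y)) (tagged a))))

Hom-⊕ʳ : ∀ {Z X Y} → Connected Z → Fin (size Z) → Hom Z (X ⊕ Y) ↔ (Hom Z X ⊎ Hom Z Y)
Hom-⊕ʳ {Z} {X} {Y} Z-connected z₀ = mk↔ₛ′ (classify ∘ lands Z-connected z₀) [ i₁ ∘ʰ_ , i₂ ∘ʰ_ ]′
  (λ { (inj₁ H₁) → classify-ι₁ H₁ (lands Z-connected z₀ (i₁ ∘ʰ H₁))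
     ; (inj₂ H₂) → classify-ι₂ H₂ (lands Z-connected z₀ (i₂ ∘ʰ H₂)) })
  (λ H → unclassify H (lands Z-connected z₀ H))
  where
  i₁ = ι₁ {X} {Y}
  i₂ = ι₂ {X} {Y}

  classify : ∀ {H} → Lands H → Hom Z X ⊎ Hom Z Y
  classify (in₁ H₁ _) = inj₁ H₁
  classify (in₂ H₂ _) = inj₂ H₂

  splitAt-injective : ∀ {i j} → splitAt (size X) i ≡ splitAt (size X) j → i ≡ j
  splitAt-injective {i} {j} e =
    trans (sym (Finₚ.join-splitAt (size X) (size Y) i))
          (trans (cong (join (size X) (size Y)) e) (Finₚ.join-splitAt (size X) (size Y) j))

  splitAt-ι₁ : ∀ (H₁ : Hom Z X) a → splitAt (size X) (apply (i₁ ∘ʰ H₁) a) ≡ inj₁ (apply H₁ a)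
  splitAt-ι₁ H₁ a = trans (cong (splitAt (size X)) (trans (apply-∘ʰ i₁ H₁ a) (apply-ι₁ {X} {Y} _)))
                          (Finₚ.splitAt-↑ˡ (size X) _ (size Y))

  splitAt-ι₂ : ∀ (H₂ : Hom Z Y) a → splitAt (size X) (apply (i₂ ∘ʰ H₂) a) ≡ inj₂ (apply H₂ a)
  splitAt-ι₂ H₂ a = trans (cong (splitAt (size X)) (trans (apply-∘ʰ i₂ H₂ a) (apply-ι₂ {X} {Y} _)))
                          (Finₚ.splitAt-↑ʳ (size X) (size Y) _)

  classify-ι₁ : ∀ H₁ (l : Lands (i₁ ∘ʰ H₁)) → classify l ≡ inj₁ H₁
  classify-ι₁ H₁ (in₁ H₁′ lands₁) =
    cong inj₁ (Hom-≡ λ a → inj₁-injective (trans (sym (lands₁ a)) (splitAt-ι₁ H₁ a)))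
  classify-ι₁ H₁ (in₂ H₂ lands₂)  = contradiction (trans (sym (splitAt-ι₁ H₁ z₀)) (lands₂ z₀)) λ ()

  classify-ι₂ : ∀ H₂ (l : Lands (i₂ ∘ʰ H₂)) → classify l ≡ inj₂ H₂
  classify-ι₂ H₂ (in₁ H₁ lands₁)  = contradiction (trans (sym (splitAt-ι₂ H₂ z₀)) (lands₁ z₀)) λ ()
  classify-ι₂ H₂ (in₂ H₂′ lands₂) =
    cong inj₂ (Hom-≡ λ a → inj₂-injective (trans (sym (lands₂ a)) (splitAt-ι₂ H₂ a)))

  unclassify : ∀ H (l : Lands H) → [ i₁ ∘ʰ_ , i₂ ∘ʰ_ ]′ (classify l) ≡ H
  unclassify H (in₁ H₁ lands₁) = Hom-≡ λ a → splitAt-injective (trans (splitAt-ι₁ H₁ a) (sym (lands₁ a)))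
  unclassify H (in₂ H₂ lands₂) = Hom-≡ λ a → splitAt-injective (trans (splitAt-ι₂ H₂ a) (sym (lands₂ a)))

-- Kernels and quotients

first : ∀ {n} → (Fin (suc n) → Bool) → Fin (suc n)
first {zero}  p = zero
first {suc n} p = if p zero then zero else suc (first (p ∘ suc))

first-satisfies : ∀ {n} (p : Fin (suc n) → Bool) {i} → T (p i) → T (p (first p))
first-satisfies {zero}  p {zero} sat = sat
first-satisfies {suc n} p {i} sat with p zero in p0
... | true = subst T (sym p0) tt
first-satisfies {suc n} p {zero}  sat | false = ⊥-elim (subst T p0 sat)
first-satisfies {suc n} p {suc i} sat | false = first-satisfies (p ∘ suc) sat

first-cong : ∀ {n} {p q : Fin (suc n) → Bool} → (∀ i → p i ≡ q i) → first p ≡ first q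
first-cong {zero}  _ = refl
first-cong {suc n} {p} {q} p≗q rewrite p≗q zero | first-cong {p = p ∘ suc} {q = q ∘ suc} (p≗q ∘ suc) = refl

⌊⌋-⇔ : ∀ {P Q : Set} → P ⇔ Q → (p? : Dec P) (q? : Dec Q) → ⌊ p? ⌋ ≡ ⌊ q? ⌋
⌊⌋-⇔ P⇔Q p? q? = trans (isYes≗does p?) (trans (does-⇔ P⇔Q p? q?) (sym (isYes≗does q?)))

SameKernel : ∀ {n} {B C : Set} → (Fin n → B) → (Fin n → C) → Set
SameKernel h h′ = ∀ a b → (h a ≡ h b) ⇔ (h′ a ≡ h′ b)

module _ {n} {B C : Set} {f : Fin n → B} {g : Fin n → C} where

  SameKernel-sym : SameKernel f g → SameKernel g f
  SameKernel-sym fg a b = ⇔.sym (fg a b)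

  SameKernel-trans : ∀ {D : Set} {h : Fin n → D} → SameKernel f g → SameKernel g h → SameKernel f h
  SameKernel-trans fg gh a b = ⇔.trans (fg a b) (gh a b)

≗⇒SameKernel : ∀ {n} {B : Set} {f g : Fin n → B} → (∀ a → f a ≡ g a) → SameKernel f g
≗⇒SameKernel f≗g a b =
  mk⇔ (λ e → trans (sym (f≗g a)) (trans e (f≗g b))) (λ e → trans (f≗g a) (trans e (sym (f≗g b))))

-- The least point with the same image as a.  By kernelRep-cong it depends only
-- on the kernel of h, so the table of kernelRep h is a canonical name for it.
kernelRep : ∀ {n m} → (Fin n → Fin m) → Fin n → Fin n
kernelRep {suc n} h a = first (λ b → ⌊ h b Finₚ.≟ h a ⌋)

kernelRep-image : ∀ {n m} (h : Fin n → Fin m) a → h (kernelRep h a) ≡ h a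
kernelRep-image {suc _} h a =
  toWitness (first-satisfies (λ b → ⌊ h b Finₚ.≟ h a ⌋) (fromWitness {a? = h a Finₚ.≟ h a} refl))

kernelRep-cong : ∀ {n m m′} {h : Fin n → Fin m} {h′ : Fin n → Fin m′} →
                 SameKernel h h′ → ∀ a → kernelRep h a ≡ kernelRep h′ a
kernelRep-cong {suc _} {h = h} {h′} same a =
  first-cong λ b → ⌊⌋-⇔ (same b a) (h b Finₚ.≟ h a) (h′ b Finₚ.≟ h′ a)

kernelRep-resp : ∀ {n m} (h : Fin n → Fin m) {a b} → h a ≡ h b → kernelRep h a ≡ kernelRep h b
kernelRep-resp {suc _} h {a} {b} ha≡hb = first-cong λ c →
  ⌊⌋-⇔ (mk⇔ (λ e → trans e ha≡hb) (λ e → trans e (sym ha≡hb))) (h c Finₚ.≟ h a) (h c Finₚ.≟ h b)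

kernelRep-sameKernel : ∀ {n m} (h : Fin n → Fin m) → SameKernel (kernelRep h) h
kernelRep-sameKernel h a b = mk⇔
  (λ e → trans (sym (kernelRep-image h a)) (trans (cong h e) (kernelRep-image h b)))
  (kernelRep-resp h)

kernelRep-injective : ∀ {n m} {h : Fin n → Fin m} → Injective _≡_ _≡_ h → ∀ a → kernelRep h a ≡ a
kernelRep-injective {h = h} h-inj a = h-inj (kernelRep-image h a)

kernelRep≗id⇒injective : ∀ {n m} {h : Fin n → Fin m} → (∀ a → kernelRep h a ≡ a) → Injective _≡_ _≡_ h
kernelRep≗id⇒injective {h = h} rep≗id {a} {b} ha≡hb =
  trans (sym (rep≗id a)) (trans (kernelRep-resp h ha≡hb) (rep≗id b))

kernel : Hom Z X → Vec (Fin (size Z)) (size Z)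
kernel H = tabulate (kernelRep (apply H))

Fibre : (Z X : FDDS) → Vec (Fin (size Z)) (size Z) → Set
Fibre Z X r = Σ[ H ∈ Hom Z X ] kernel H ≡ r

-- Injective homomorphisms (Emb-injective, injective⇒Emb), presented as the fibre
-- of kernel over the identity.
Emb : FDDS → FDDS → Set
Emb Z X = Fibre Z X (allFin (size Z))

Fibre-≡ : ∀ {Z X r} {E E′ : Fibre Z X r} → proj₁ E ≡ proj₁ E′ → E ≡ E′
Fibre-≡ {E = H , p} {E′ = .H , q} refl = cong (H ,_) (Decidable⇒UIP.≡-irrelevant (Vecₚ.≡-dec Finₚ._≟_) p q)

kernel≡⇒≗ : ∀ {Z X r} (H : Hom Z X) → kernel H ≡ r → ∀ a → kernelRep (apply H) a ≡ lookup r a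
kernel≡⇒≗ H refl a = sym (lookup∘tabulate (kernelRep (apply H)) a)

≗⇒kernel≡ : ∀ {Z X r} (H : Hom Z X) → (∀ a → kernelRep (apply H) a ≡ lookup r a) → kernel H ≡ r
≗⇒kernel≡ {r = r} H rep≗r = trans (tabulate-cong rep≗r) (tabulate∘lookup r)

Fibre-sameKernel : ∀ {Z X r} ((H , _) : Fibre Z X r) → SameKernel (apply H) (lookup r)
Fibre-sameKernel (H , ker≡r) =
  SameKernel-trans (SameKernel-sym (kernelRep-sameKernel (apply H))) (≗⇒SameKernel (kernel≡⇒≗ H ker≡r))

Emb-injective : ∀ {Z X} ((H , _) : Emb Z X) → Injective _≡_ _≡_ (apply H)
Emb-injective (H , ker≡id) = kernelRep≗id⇒injective λ a → trans (kernel≡⇒≗ H ker≡id a) (lookup-allFin a)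

injective⇒Emb : ∀ {Z X} (H : Hom Z X) → Injective _≡_ _≡_ (apply H) → Emb Z X
injective⇒Emb H H-inj = H , ≗⇒kernel≡ H λ a → trans (kernelRep-injective H-inj a) (sym (lookup-allFin a))

idEmb : Emb X X
idEmb = injective⇒Emb idʰ λ e → trans (sym (lookup∘tabulate id _)) (trans e (lookup∘tabulate id _))

-- r is the table of least representatives of an equivalence relation on the
-- points of Z that is compatible with the dynamics.
record IsKernel (Z : FDDS) (r : Vec (Fin (size Z)) (size Z)) : Set where
  field
    canonical  : ∀ a → kernelRep (lookup r) a ≡ lookup r a
    compatible : ∀ a b → lookup r a ≡ lookup r b → lookup r (map Z a) ≡ lookup r (map Z b)

isKernel? : ∀ Z → Decidable (IsKernel Z)
isKernel? Z r = map′ (λ (c , k) → record { canonical = c ; compatible = k })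
  (λ r-ker → IsKernel.canonical r-ker , IsKernel.compatible r-ker)
  (Finₚ.all? (λ a → kernelRep ρ a Finₚ.≟ ρ a) ×-dec
   Finₚ.all? λ a → Finₚ.all? λ b → (ρ a Finₚ.≟ ρ b) →-dec (ρ (map Z a) Finₚ.≟ ρ (map Z b)))
  where ρ = lookup r

kernel-isKernel : ∀ {Z X} (H : Hom Z X) → IsKernel Z (kernel H)
kernel-isKernel {Z} {X} H = record
  { canonical  = λ a → trans (kernelRep-cong same a) (kernel≡⇒≗ H refl a)
  ; compatible = λ a b e → Equivalence.from (same (map Z a) (map Z b))
      (trans (apply-isHom H a) (trans (cong (map X) (Equivalence.to (same a b) e)) (sym (apply-isHom H b))))
  }
  where
  same : SameKernel (lookup (kernel H)) (apply H)
  same = SameKernel-trans (≗⇒SameKernel (lookup∘tabulate (kernelRep (apply H)))) (kernelRep-sameKernel (apply H))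

Fibre-empty : ∀ {Z X r} → ¬ IsKernel Z r → Fibre Z X r ↔ ⊥
Fibre-empty ¬r-ker = mk↔ₛ′ (λ (H , ker≡r) → ¬r-ker (subst (IsKernel _) ker≡r (kernel-isKernel H)))
  (λ ()) (λ ()) (λ (H , ker≡r) → ⊥-elim (¬r-ker (subst (IsKernel _) ker≡r (kernel-isKernel H))))

module Quotient (Z : FDDS) (r : Vec (Fin (size Z)) (size Z)) (r-kernel : IsKernel Z r) where
  open IsKernel r-kernel

  private
    ρ : Fin (size Z) → Fin (size Z)
    ρ = lookup r

  ρ-idempotent : ∀ a → ρ (ρ a) ≡ ρ a
  ρ-idempotent a = trans (cong ρ (sym (canonical a))) (kernelRep-image ρ a)

  IsRep : Fin (size Z) → Bool
  IsRep a = ⌊ ρ a Finₚ.≟ a ⌋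

  reps : Subtype (Fin (size Z)) IsRep ↔ Fin (count IsRep)
  reps = Subtype-Fin↔ IsRep

  quot : Fin (size Z) → Fin (count IsRep)
  quot a = to reps (ρ a , fromWitness (ρ-idempotent a))

  rep : Fin (count IsRep) → Fin (size Z)
  rep = proj₁ ∘ from reps

  rep-quot : ∀ a → rep (quot a) ≡ ρ a
  rep-quot a = cong proj₁ (strictlyInverseʳ reps _)

  quot-rep : ∀ j → quot (rep j) ≡ j
  quot-rep j = trans (cong (to reps) (Subtype-≡ (toWitness (proj₂ (from reps j))))) (strictlyInverseˡ reps j)

  quot-resp : ∀ {a b} → ρ a ≡ ρ b → quot a ≡ quot b
  quot-resp ρa≡ρb = cong (to reps) (Subtype-≡ ρa≡ρb)

  quot-sameKernel : SameKernel quot ρ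
  quot-sameKernel a b = mk⇔ (λ e → trans (sym (rep-quot a)) (trans (cong rep e) (rep-quot b))) quot-resp

  quotient : FDDS
  quotient = mkFDDS (count IsRep) (quot ∘ map Z ∘ rep)

  quotient-smaller : ∀ {a} → ρ a ≢ a → size quotient < size Z
  quotient-smaller ρa≢a = count< IsRep (ρa≢a ∘ toWitness)

  quotʰ : Hom Z quotient
  quotʰ = mkHom quot λ a →
    quot-resp (compatible a (rep (quot a)) (sym (trans (cong ρ (rep-quot a)) (ρ-idempotent a))))

  module _ {X : FDDS} where

    apply-ρ : ((H , _) : Fibre Z X r) → ∀ a → apply H (ρ a) ≡ apply H a
    apply-ρ F a = Equivalence.from (Fibre-sameKernel F (ρ a) a) (ρ-idempotent a)

    descend : Fibre Z X r → Emb quotient X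
    descend F@(H , _) = injective⇒Emb descendʰ λ {i} {j} e → begin
      i                ≡⟨ quot-rep i ⟨
      quot (rep i)     ≡⟨ quot-resp (Equivalence.to (Fibre-sameKernel F (rep i) (rep j))
                                       (trans (sym (lookup∘tabulate _ i)) (trans e (lookup∘tabulate _ j)))) ⟩
      quot (rep j)     ≡⟨ quot-rep j ⟩
      j                ∎
      where
      open ≡-Reasoning
      descendʰ : Hom quotient X
      descendʰ = mkHom (apply H ∘ rep) λ j → begin
        apply H (rep (quot (map Z (rep j)))) ≡⟨ cong (apply H) (rep-quot _) ⟩
        apply H (ρ (map Z (rep j)))          ≡⟨ apply-ρ F _ ⟩
        apply H (map Z (rep j))              ≡⟨ apply-isHom H _ ⟩
        map X (apply H (rep j))              ∎

    lift : Emb quotient X → Fibre Z X r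
    lift E@(H , _) = H ∘ʰ quotʰ , ≗⇒kernel≡ (H ∘ʰ quotʰ) λ a →
      trans (kernelRep-cong same a) (canonical a)
      where
      same : SameKernel (apply (H ∘ʰ quotʰ)) ρ
      same = SameKernel-trans
        (≗⇒SameKernel λ a → trans (apply-∘ʰ H quotʰ a) (cong (apply H) (lookup∘tabulate quot a)))
        (SameKernel-trans (λ a b → mk⇔ (Emb-injective E) (cong (apply H))) quot-sameKernel)

    Fibre↔Emb : Fibre Z X r ↔ Emb quotient X
    Fibre↔Emb = mk↔ₛ′ descend lift
      (λ E@(H , _) → Fibre-≡ (Hom-≡ λ j → begin
        apply (proj₁ (descend (lift E))) j       ≡⟨ lookup∘tabulate (apply (H ∘ʰ quotʰ) ∘ rep) j ⟩
        apply (H ∘ʰ quotʰ) (rep j)               ≡⟨ apply-∘ʰ H quotʰ (rep j) ⟩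
        apply H (apply quotʰ (rep j))            ≡⟨ cong (apply H) (trans (lookup∘tabulate quot (rep j)) (quot-rep j)) ⟩
        apply H j                                ∎))
      (λ F@(H , _) → Fibre-≡ (Hom-≡ λ a → begin
        apply (proj₁ (lift (descend F))) a       ≡⟨ apply-∘ʰ (proj₁ (descend F)) quotʰ a ⟩
        apply (proj₁ (descend F)) (apply quotʰ a) ≡⟨ lookup∘tabulate (apply H ∘ rep) _ ⟩
        apply H (rep (apply quotʰ a))            ≡⟨ cong (apply H ∘ rep) (lookup∘tabulate quot a) ⟩
        apply H (rep (quot a))                   ≡⟨ cong (apply H) (rep-quot a) ⟩
        apply H (ρ a)                            ≡⟨ apply-ρ F a ⟩
        apply H a                                ∎))
      where open ≡-Reasoning

NonIdentity : ℕ → Set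
NonIdentity z = Subtype (Vec (Fin z) z) (λ r → isNo (Vecₚ.≡-dec Finₚ._≟_ r (allFin z)))

Hom-by-kernel : ∀ {Z X} → Hom Z X ↔ (Emb Z X ⊎ Σ (NonIdentity (size Z)) (Fibre Z X ∘ proj₁))
Hom-by-kernel = ↔-trans (Σ-fibres kernel) (Σ-split (Vecₚ.≡-dec Finₚ._≟_) (allFin _))

nonIdentity⇒moved : ∀ {n} ((r , _) : NonIdentity n) → ∃ λ a → lookup r a ≢ a
nonIdentity⇒moved (r , r≢id) = Finₚ.¬∀⟶∃¬ _ _ (λ a → lookup r a Finₚ.≟ a) λ fixed →
  toWitnessFalse r≢id (trans (sym (tabulate∘lookup r)) (tabulate-cong fixed))

module _ {X Y : FDDS} (Hom↔ : ∀ Z → Hom Z X ↔ Hom Z Y) where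

  Emb↔ : ∀ Z → Emb Z X ↔ Emb Z Y
  Emb↔ = size-rec _ λ Z smaller↔ → ⊎-cancelʳ-↔
    (Finite-↔ (↔-sym Hom-by-kernel) (Finite-Hom Z X))
    (↔-trans (↔-sym Hom-by-kernel) (↔-trans (Hom↔ Z) Hom-by-kernel))
    (Σ-↔ ↔-refl λ {m} → Fibre↔ Z smaller↔ m)
    where
    Fibre↔ : ∀ Z → (∀ {W} → size W < size Z → Emb W X ↔ Emb W Y) →
             ((r , _) : NonIdentity (size Z)) → Fibre Z X r ↔ Fibre Z Y r
    Fibre↔ Z smaller↔ m@(r , _) with isKernel? Z r
    ... | no  ¬r-ker = ↔-trans (Fibre-empty ¬r-ker) (↔-sym (Fibre-empty ¬r-ker))
    ... | yes r-ker  =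
      ↔-trans Fibre↔Emb (↔-trans (smaller↔ (quotient-smaller (proj₂ (nonIdentity⇒moved m)))) (↔-sym Fibre↔Emb))
      where open Quotient Z r r-ker

Emb⇒≅ : Emb X Y → Emb Y X → X ≅ Y
Emb⇒≅ F@(H , _) G = record
  { to       = apply H
  ; from     = proj₁ ∘ onto
  ; from∘to  = λ x → Emb-injective F (proj₂ (onto (apply H x)))
  ; to∘from  = proj₂ ∘ onto
  ; commutes = apply-isHom H
  }
  where
  onto = injective⇒surjective (Emb-injective F) (Finₚ.injective⇒≤ (Emb-injective G))

Hom↔⇒≅ : (∀ Z → Hom Z X ↔ Hom Z Y) → X ≅ Y
Hom↔⇒≅ Hom↔ = Emb⇒≅ (to (Emb↔ Hom↔ _) idEmb) (from (Emb↔ Hom↔ _) idEmb)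

-- Polynomials over ℕ

sumℕ : (m : ℕ) → (Fin m → ℕ) → ℕ
sumℕ zero    a = 0
sumℕ (suc m) a = a zero + sumℕ m (a ∘ suc)

polyFromℕ : ℕ → (m : ℕ) → (Fin m → ℕ) → ℕ → ℕ
polyFromℕ k zero    a x = 0
polyFromℕ k (suc m) a x = a zero * x ℕ.^ suc k + polyFromℕ (suc k) m (a ∘ suc) x

polyFromℕ-mono-≤ : ∀ k m a {x y} → x ≤ y → polyFromℕ k m a x ≤ polyFromℕ k m a y
polyFromℕ-mono-≤ k zero    a x≤y = z≤n
polyFromℕ-mono-≤ k (suc m) a x≤y = ℕₚ.+-mono-≤
  (ℕₚ.*-monoʳ-≤ (a zero) (ℕₚ.^-monoˡ-≤ (suc k) x≤y)) (polyFromℕ-mono-≤ (suc k) m (a ∘ suc) x≤y)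

polyFromℕ-mono-< : ∀ k m a {x y} → 0 < sumℕ m a → x < y → polyFromℕ k m a x < polyFromℕ k m a y
polyFromℕ-mono-< k (suc m) a 0<Σa x<y with a zero
... | zero   = polyFromℕ-mono-< (suc k) m (a ∘ suc) 0<Σa x<y
... | suc a₀ = ℕₚ.+-mono-<-≤ (ℕₚ.*-monoʳ-< (suc a₀) (ℕₚ.^-monoˡ-< (suc k) x<y))
                             (polyFromℕ-mono-≤ (suc k) m (a ∘ suc) (ℕₚ.<⇒≤ x<y))

polyFromℕ-zero : ∀ k m a x → sumℕ m a ≡ 0 → polyFromℕ k m a x ≡ 0
polyFromℕ-zero k zero    a x _    = refl
polyFromℕ-zero k (suc m) a x Σa≡0 = cong₂ _+_
  (cong (_* x ℕ.^ suc k) (ℕₚ.m+n≡0⇒m≡0 (a zero) Σa≡0))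
  (polyFromℕ-zero (suc k) m (a ∘ suc) x (ℕₚ.m+n≡0⇒n≡0 (a zero) Σa≡0))

strictMono⇒injective : ∀ {f : ℕ → ℕ} → (∀ {x y} → x < y → f x < f y) →
                       ∀ {x y} → f x ≡ f y → x ≡ y
strictMono⇒injective f-mono {x} {y} fx≡fy with ℕₚ.<-cmp x y
... | tri< x<y _ _ = contradiction fx≡fy (ℕₚ.<⇒≢ (f-mono x<y))
... | tri≈ _ x≡y _ = x≡y
... | tri> _ _ y<x = contradiction (sym fx≡fy) (ℕₚ.<⇒≢ (f-mono y<x))

-- Both sides hold iff x ≡ y, unless all coefficients vanish, when both hold trivially.
polyFromℕ-≡⇔ : ∀ k m a x y → (polyFromℕ k m a x ≡ polyFromℕ k m a y) ⇔ (sumℕ m a * x ≡ sumℕ m a * y)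
polyFromℕ-≡⇔ k m a x y with sumℕ m a in Σa≡
... | zero  = mk⇔ (λ _ → refl) λ _ → trans (polyFromℕ-zero k m a x Σa≡) (sym (polyFromℕ-zero k m a y Σa≡))
... | suc s = mk⇔
  (λ e → cong (suc s *_) (strictMono⇒injective (polyFromℕ-mono-< k m a (subst (0 <_) (sym Σa≡) (s≤s z≤n))) e))
  (λ e → cong (polyFromℕ k m a) (ℕₚ.*-cancelˡ-≡ x y (suc s) e))

-- Counting homomorphisms

hom# : FDDS → FDDS → ℕ
hom# Z X = proj₁ (Finite-Hom Z X)

Hom↔Fin : ∀ Z X → Hom Z X ↔ Fin (hom# Z X)
Hom↔Fin Z X = proj₂ (Finite-Hom Z X)

hom#-unique : ∀ Z X {k} → Hom Z X ↔ Fin k → hom# Z X ≡ k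
hom#-unique Z X = ↔Fin-unique (Hom↔Fin Z X)

hom#-≡⇒↔ : ∀ {Z X Y} → hom# Z X ≡ hom# Z Y → Hom Z X ↔ Hom Z Y
hom#-≡⇒↔ {Z} {X} {Y} eq =
  ↔-trans (Hom↔Fin Z X) (subst (λ k → Fin k ↔ Hom Z Y) (sym eq) (↔-sym (Hom↔Fin Z Y)))

hom#-resp-≅ : ∀ {Z X Y} → X ≅ Y → hom# Z X ≡ hom# Z Y
hom#-resp-≅ {Z} {X} {Y} X≅Y = hom#-unique Z X (↔-trans (Hom-resp-≅ʳ X≅Y) (Hom↔Fin Z Y))

hom#-⊗ : ∀ Z X Y → hom# Z (X ⊗ Y) ≡ hom# Z X * hom# Z Y
hom#-⊗ Z X Y = hom#-unique Z (X ⊗ Y)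
  (↔-trans Hom-⊗ (↔-trans (Hom↔Fin Z X ×-↔ Hom↔Fin Z Y) (↔-sym Finₚ.*↔×)))

hom#-^ : ∀ Z X k → hom# Z (X ^ k) ≡ hom# Z X ℕ.^ k
hom#-^ Z X zero    = hom#-unique Z 𝟙 (↔-trans Hom-𝟙 (↔-sym Finₚ.1↔⊤))
hom#-^ Z X (suc k) = trans (hom#-⊗ Z X (X ^ k)) (cong (hom# Z X *_) (hom#-^ Z X k))

module _ {Z : FDDS} (Z-connected : Connected Z) (z₀ : Fin (size Z)) where

  hom#-𝟘 : hom# Z 𝟘 ≡ 0
  hom#-𝟘 = hom#-unique Z 𝟘 (↔-trans (Hom-𝟘 z₀) (↔-sym Finₚ.0↔⊥))

  hom#-⊕ : ∀ X Y → hom# Z (X ⊕ Y) ≡ hom# Z X + hom# Z Y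
  hom#-⊕ X Y = hom#-unique Z (X ⊕ Y)
    (↔-trans (Hom-⊕ʳ Z-connected z₀) (↔-trans (Hom↔Fin Z X ⊎-↔ Hom↔Fin Z Y) (↔-sym Finₚ.+↔⊎)))

  hom#-polyFrom : ∀ k m A X → hom# Z (polyFrom k m A X) ≡ polyFromℕ k m (hom# Z ∘ A) (hom# Z X)
  hom#-polyFrom k zero    A X = hom#-𝟘
  hom#-polyFrom k (suc m) A X = begin
    hom# Z (A zero ⊗ X ^ suc k ⊕ polyFrom (suc k) m (A ∘ suc) X)
      ≡⟨ hom#-⊕ (A zero ⊗ X ^ suc k) (polyFrom (suc k) m (A ∘ suc) X) ⟩
    hom# Z (A zero ⊗ X ^ suc k) + hom# Z (polyFrom (suc k) m (A ∘ suc) X)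
      ≡⟨ cong₂ _+_ (trans (hom#-⊗ Z (A zero) (X ^ suc k)) (cong (hom# Z (A zero) *_) (hom#-^ Z X (suc k))))
                   (hom#-polyFrom (suc k) m (A ∘ suc) X) ⟩
    hom# Z (A zero) * hom# Z X ℕ.^ suc k + polyFromℕ (suc k) m (hom# Z ∘ A ∘ suc) (hom# Z X) ∎
    where open ≡-Reasoning

  hom#-sumCoeffs : ∀ m A → hom# Z (sumCoeffs m A) ≡ sumℕ m (hom# Z ∘ A)
  hom#-sumCoeffs zero    A = hom#-𝟘
  hom#-sumCoeffs (suc m) A =
    trans (hom#-⊕ (A zero) (sumCoeffs m (A ∘ suc))) (cong (hom# Z (A zero) +_) (hom#-sumCoeffs m (A ∘ suc)))

  hom#-M : ∀ m A X → hom# Z (M m A X) ≡ sumℕ m (hom# Z ∘ A) * hom# Z X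
  hom#-M m A X = trans (hom#-⊗ Z (sumCoeffs m A) X) (cong (_* hom# Z X) (hom#-sumCoeffs m A))

≅⇔hom#-connected : ∀ {X Y} → (X ≅ Y) ⇔ (∀ Z → Connected Z → Fin (size Z) → hom# Z X ≡ hom# Z Y)
≅⇔hom#-connected = mk⇔ (λ X≅Y Z _ _ → hom#-resp-≅ {Z} X≅Y)
  (λ same → Hom↔⇒≅ (Hom↔-of-connected λ Z Z-connected z₀ → hom#-≡⇒↔ (same Z Z-connected z₀)))

P≅⇔M≅ : ∀ m A X Y → (P m A X ≅ P m A Y) ⇔ (M m A X ≅ M m A Y)
P≅⇔M≅ m A X Y = ⇔.trans ≅⇔hom#-connected (⇔.trans
  (mk⇔ (λ same Z c z₀ → Equivalence.to (counts Z c z₀) (same Z c z₀))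
       (λ same Z c z₀ → Equivalence.from (counts Z c z₀) (same Z c z₀)))
  (⇔.sym ≅⇔hom#-connected))
  where
  counts : ∀ Z → Connected Z → Fin (size Z) →
           (hom# Z (P m A X) ≡ hom# Z (P m A Y)) ⇔ (hom# Z (M m A X) ≡ hom# Z (M m A Y))
  counts Z c z₀
    rewrite hom#-polyFrom c z₀ 0 m A X | hom#-polyFrom c z₀ 0 m A Y | hom#-M c z₀ m A X | hom#-M c z₀ m A Y
    = polyFromℕ-≡⇔ 0 m (hom# Z ∘ A) (hom# Z X) (hom# Z Y)

proposition5 : (m : ℕ) (A : Fin m → FDDS) →
    (InjectiveFDDS (P m A) → InjectiveFDDS (M m A)) ×
    (InjectiveFDDS (M m A) → InjectiveFDDS (P m A))
proposition5 m A =
  (λ P-injective X Y → P-injective X Y ∘ Equivalence.from (P≅⇔M≅ m A X Y)) ,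
  (λ M-injective X Y → M-injective X Y ∘ Equivalence.to (P≅⇔M≅ m A X Y))
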